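{- Let $f:\mathbb{Z}_+\to\mathbb{R}$ be an arithmetic function that is not identically zero. Then $f$ is L-additive if and only if $f$ is uniquely $gh$-decomposable, i.e., there is exactly one pair $(g,h)$ with $g$ completely additive, $h$ nonzero-valued and completely multiplicative, and $f=gh$.
   Context: An arithmetic function $g$ is completely additive if $g(mn)=g(m)+g(n)$ for all $m,n\in\mathbb{Z}_+$. An arithmetic function $h$ is completely multiplicative if $h(1)=1$ and $h(mn)=h(m)h(n)$ for all $m,n\in\mathbb{Z}_+$. An arithmetic function $f$ is L-additive if there is a nonzero-valued completely multiplicative function $h_f$ such that $f(mn)=f(m)h_f(n)+f(n)h_f(m)$ for all $m,n\in\mathbb{Z}_+$. -}

module Defs where

open import Level using (Level; _⊔_) renaming (suc to lsuc)
open import Algebra.Bundles using (CommutativeRing)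
open import Data.Nat using (ℕ; NonZero) renaming (_*_ to _*ℕ_)
open import Data.Nat.Properties using (m*n≢0)
open import Data.Product using (Σ; ∃; _×_; _,_)
open import Relation.Nullary using (¬_)

record Field (c ℓ : Level) : Set (lsuc (c ⊔ ℓ)) where
  field
    commutativeRing : CommutativeRing c ℓ
  open CommutativeRing commutativeRing public
  field
    0≉1     : ¬ (0# ≈ 1#)
    inverse : ∀ x → ¬ (x ≈ 0#) → ∃ λ y → x * y ≈ 1#

module _ {c ℓ : Level} (F : Field c ℓ) where
  open Field F

  -- Arithmetic functions ℤ₊ → F are represented as functions ℕ → Carrier;
  -- only their values at positive arguments matter (the value at 0 is ignored).
  ArithFun : Set c
  ArithFun = ℕ → Carrier

  _≐_ : ArithFun → ArithFun → Set ℓ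
  f ≐ f' = ∀ n → .{{_ : NonZero n}} → f n ≈ f' n

  _·_ : ArithFun → ArithFun → ArithFun
  (g · h) n = g n * h n

  NotIdenticallyZero : ArithFun → Set ℓ
  NotIdenticallyZero f = ∃ λ n → NonZero n × ¬ (f n ≈ 0#)

  CompletelyAdditive : ArithFun → Set ℓ
  CompletelyAdditive g =
    ∀ m n → .{{_ : NonZero m}} → .{{_ : NonZero n}} → g (m *ℕ n) ≈ g m + g n

  CompletelyMultiplicative : ArithFun → Set ℓ
  CompletelyMultiplicative h =
    (h 1 ≈ 1#) ×
    (∀ m n → .{{_ : NonZero m}} → .{{_ : NonZero n}} → h (m *ℕ n) ≈ h m * h n)

  NonzeroValued : ArithFun → Set ℓ
  NonzeroValued h = ∀ n → .{{_ : NonZero n}} → ¬ (h n ≈ 0#)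

  LAdditive : ArithFun → Set (c ⊔ ℓ)
  LAdditive f = ∃ λ (hf : ArithFun) →
    NonzeroValued hf × CompletelyMultiplicative hf ×
    (∀ m n → .{{_ : NonZero m}} → .{{_ : NonZero n}} →
       f (m *ℕ n) ≈ f m * hf n + f n * hf m)

  GHDecomposition : ArithFun → ArithFun → ArithFun → Set ℓ
  GHDecomposition f g h =
    CompletelyAdditive g × NonzeroValued h × CompletelyMultiplicative h × (f ≐ (g · h))

  UniquelyGHDecomposable : ArithFun → Set (c ⊔ ℓ)
  UniquelyGHDecomposable f =
    (∃ λ (gh : ArithFun × ArithFun) → let (g , h) = gh in GHDecomposition f g h) ×
    (∀ g h g' h' → GHDecomposition f g h → GHDecomposition f g' h' → (g ≐ g') × (h ≐ h'))

{-# OPTIONS --safe #-}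
module Submission where

-- If f = g·h is a gh-decomposition, then f(mn) = (g m + g n) h m h n = f m h n + f n h m,
-- so f is L-additive with multiplier h. Conversely, given the multiplier h_f of an
-- L-additive f, the quotient g = f / h_f is completely additive. The multiplier is
-- determined by f: comparing f(n₀²) = 2 f(n₀) h(n₀) for some n₀ with f(n₀) ≠ 0 fixes
-- h(n₀) (this is where 2 ≠ 0 is needed), and then f(n₀ n) = f n₀ h n + f n h n₀ fixes
-- every h(n); finally g = f / h is fixed too.

open import Defs
open import Level using (Level)
open import Data.Product using (_×_; _,_; proj₁; proj₂)
open import Relation.Nullary using (¬_)
open import Data.Nat using (zero; suc; NonZero) renaming (_*_ to _*ℕ_)
open import Data.Nat.Properties using (m*n≢0)
open import Algebra.Definitions using (AlmostLeftCancellative)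

module _ {c ℓ : Level} (F : Field c ℓ) where
  open Field F
  open import Algebra.Properties.Group +-group using (∙-cancelʳ)
  open import Relation.Binary.Reasoning.Setoid setoid
  open import Algebra.Solver.Ring.NaturalCoefficients.Default commutativeSemiring

  *-almostCancelˡ : AlmostLeftCancellative _≈_ 0# _*_
  *-almostCancelˡ a x y a≉0 ax≈ay with inverse a a≉0
  ... | b , ab≈1 = begin
    x            ≈⟨ sym (*-identityˡ x) ⟩
    1# * x       ≈⟨ *-congʳ (sym ab≈1) ⟩
    (a * b) * x  ≈⟨ solve 3 (λ a b x → (a :* b) :* x := b :* (a :* x)) refl a b x ⟩
    b * (a * x)  ≈⟨ *-congˡ ax≈ay ⟩
    b * (a * y)  ≈⟨ solve 3 (λ a b y → b :* (a :* y) := (a :* b) :* y) refl a b y ⟩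
    (a * b) * y  ≈⟨ *-congʳ ab≈1 ⟩
    1# * y       ≈⟨ *-identityˡ y ⟩
    y            ∎

  x*y≉0 : ∀ {x y} → ¬ (x ≈ 0#) → ¬ (y ≈ 0#) → ¬ (x * y ≈ 0#)
  x*y≉0 {x} {y} x≉0 y≉0 xy≈0 = y≉0 (*-almostCancelˡ x y 0# x≉0 (trans xy≈0 (sym (zeroʳ x))))

  LeibnizRule : ArithFun F → ArithFun F → Set ℓ
  LeibnizRule f h = ∀ m n → .{{_ : NonZero m}} → .{{_ : NonZero n}} →
    f (m *ℕ n) ≈ f m * h n + f n * h m

  ghDecomposition⇒leibnizRule : ∀ {f g h} → GHDecomposition F f g h → LeibnizRule f h
  ghDecomposition⇒leibnizRule {f} {g} {h} (g-add , _ , (_ , h-mul) , f≐gh) m n = begin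
    f (m *ℕ n)                             ≈⟨ f≐gh (m *ℕ n) {{m*n≢0 m n}} ⟩
    g (m *ℕ n) * h (m *ℕ n)                ≈⟨ *-cong (g-add m n) (h-mul m n) ⟩
    (g m + g n) * (h m * h n)              ≈⟨ solve 4 (λ a b x y → (a :+ b) :* (x :* y) := (a :* x) :* y :+ (b :* y) :* x)
                                                refl (g m) (g n) (h m) (h n) ⟩
    (g m * h m) * h n + (g n * h n) * h m  ≈⟨ sym (+-cong (*-congʳ (f≐gh m)) (*-congʳ (f≐gh n))) ⟩
    f m * h n + f n * h m                  ∎

  leibnizRule-multiplier-unique : ¬ ((1# + 1#) ≈ 0#) → ∀ {f h h'} → NotIdenticallyZero F f →
    LeibnizRule f h → LeibnizRule f h' → _≐_ F h h'
  leibnizRule-multiplier-unique 2≉0 {f} {h} {h'} (n₀ , n₀≢0 , fn₀≉0) rule rule' n =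
    *-almostCancelˡ (f n₀) (h n) (h' n) fn₀≉0
      (∙-cancelʳ (f n * h n₀) _ _ (begin
        f n₀ * h n + f n * h n₀   ≈⟨ sym (rule n₀ n) ⟩
        f (n₀ *ℕ n)               ≈⟨ rule' n₀ n ⟩
        f n₀ * h' n + f n * h' n₀ ≈⟨ +-congˡ (*-congˡ (sym h≈h'-at-n₀)) ⟩
        f n₀ * h' n + f n * h n₀  ∎))
    where
    instance
      _ : NonZero n₀
      _ = n₀≢0

    double : ∀ x y → (x * y + x * y) ≈ ((1# + 1#) * x) * y
    double = solve 2 (λ x y → x :* y :+ x :* y := ((con 1 :+ con 1) :* x) :* y) refl

    h≈h'-at-n₀ : h n₀ ≈ h' n₀
    h≈h'-at-n₀ = *-almostCancelˡ ((1# + 1#) * f n₀) (h n₀) (h' n₀) (x*y≉0 2≉0 fn₀≉0) (begin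
      ((1# + 1#) * f n₀) * h n₀  ≈⟨ sym (double (f n₀) (h n₀)) ⟩
      f n₀ * h n₀ + f n₀ * h n₀  ≈⟨ sym (rule n₀ n₀) ⟩
      f (n₀ *ℕ n₀)               ≈⟨ rule' n₀ n₀ ⟩
      f n₀ * h' n₀ + f n₀ * h' n₀ ≈⟨ double (f n₀) (h' n₀) ⟩
      ((1# + 1#) * f n₀) * h' n₀ ∎)

  ghDecomposition-unique : ¬ ((1# + 1#) ≈ 0#) → ∀ {f g h g' h'} → NotIdenticallyZero F f →
    GHDecomposition F f g h → GHDecomposition F f g' h' → (_≐_ F g g') × (_≐_ F h h')
  ghDecomposition-unique 2≉0 {f} {g} {h} {g'} {h'} f≢0 D@(_ , h≉0 , _ , f≐gh) D'@(_ , _ , _ , f≐g'h') =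
    g≐g' , h≐h'
    where
    h≐h' : _≐_ F h h'
    h≐h' = leibnizRule-multiplier-unique 2≉0 f≢0
      (ghDecomposition⇒leibnizRule D) (ghDecomposition⇒leibnizRule D')

    g≐g' : _≐_ F g g'
    g≐g' n = *-almostCancelˡ (h n) (g n) (g' n) (h≉0 n) (begin
      h n * g n    ≈⟨ *-comm (h n) (g n) ⟩
      g n * h n    ≈⟨ sym (f≐gh n) ⟩
      f n          ≈⟨ f≐g'h' n ⟩
      g' n * h' n  ≈⟨ *-congˡ (sym (h≐h' n)) ⟩
      g' n * h n   ≈⟨ *-comm (g' n) (h n) ⟩
      h n * g' n   ∎)

  reciprocal : ∀ h → NonzeroValued F h → ArithFun F
  reciprocal h h≉0 zero    = 0#
  reciprocal h h≉0 (suc k) = proj₁ (inverse (h (suc k)) (h≉0 (suc k)))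

  *-reciprocal : ∀ h (h≉0 : NonzeroValued F h) n → .{{_ : NonZero n}} →
    h n * reciprocal h h≉0 n ≈ 1#
  *-reciprocal h h≉0 (suc k) = proj₂ (inverse (h (suc k)) (h≉0 (suc k)))

  leibnizRule⇒ghDecomposition : ∀ {f h} (h≉0 : NonzeroValued F h) → CompletelyMultiplicative F h →
    LeibnizRule f h → GHDecomposition F f (_·_ F f (reciprocal h h≉0)) h
  leibnizRule⇒ghDecomposition {f} {h} h≉0 h-cm@(_ , h-mul) rule =
    g-add , h≉0 , h-cm , λ n → sym (trans (*-comm (g n) (h n)) (h*g≈f n))
    where
    g : ArithFun F
    g = _·_ F f (reciprocal h h≉0)

    h*g≈f : ∀ n → .{{_ : NonZero n}} → h n * g n ≈ f n
    h*g≈f n = begin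
      h n * (f n * reciprocal h h≉0 n)  ≈⟨ solve 3 (λ a b c → a :* (b :* c) := b :* (a :* c)) refl _ _ _ ⟩
      f n * (h n * reciprocal h h≉0 n)  ≈⟨ *-congˡ (*-reciprocal h h≉0 n) ⟩
      f n * 1#                          ≈⟨ *-identityʳ (f n) ⟩
      f n                               ∎

    g-add : CompletelyAdditive F g
    g-add m n = *-almostCancelˡ (h (m *ℕ n)) _ _ (h≉0 (m *ℕ n) {{m*n≢0 m n}}) (begin
      h (m *ℕ n) * g (m *ℕ n)                ≈⟨ h*g≈f (m *ℕ n) {{m*n≢0 m n}} ⟩
      f (m *ℕ n)                             ≈⟨ rule m n ⟩
      f m * h n + f n * h m                  ≈⟨ sym (+-cong (*-congʳ (h*g≈f m)) (*-congʳ (h*g≈f n))) ⟩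
      (h m * g m) * h n + (h n * g n) * h m  ≈⟨ solve 4 (λ a b x y → (x :* a) :* y :+ (y :* b) :* x := (x :* y) :* (a :+ b))
                                                  refl (g m) (g n) (h m) (h n) ⟩
      (h m * h n) * (g m + g n)              ≈⟨ *-congʳ (sym (h-mul m n)) ⟩
      h (m *ℕ n) * (g m + g n)               ∎)

corollary6 : {c ℓ : Level} (F : Field c ℓ) →
    let open Field F in
    ¬ ((1# + 1#) ≈ 0#) →
    (f : ArithFun F) → NotIdenticallyZero F f →
    (LAdditive F f → UniquelyGHDecomposable F f) × (UniquelyGHDecomposable F f → LAdditive F f)
corollary6 F 2≉0 f f≢0 = L-additive⇒unique , unique⇒L-additive
  where
  L-additive⇒unique : LAdditive F f → UniquelyGHDecomposable F f
  L-additive⇒unique (h , h≉0 , h-cm , rule) =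
    (_ , leibnizRule⇒ghDecomposition F h≉0 h-cm rule) ,
    λ _ _ _ _ → ghDecomposition-unique F 2≉0 f≢0

  unique⇒L-additive : UniquelyGHDecomposable F f → LAdditive F f
  unique⇒L-additive (((g , h) , D@(_ , h≉0 , h-cm , _)) , _) =
    h , h≉0 , h-cm , ghDecomposition⇒leibnizRule F D
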